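{- Let $n\ge 0$. For every partition $\phi$ of $\{1,\ldots,n+1\}$ there is exactly one subset $S\subseteq\{1,\ldots,n\}$ with $\phi\in\Pi_S$; that is, the classes $\Pi_S$, $S\subseteq\{1,\ldots,n\}$, are pairwise disjoint and their union is the set $\Pi_{n+1}$ of all partitions of $\{1,\ldots,n+1\}$.
   Context: For $S\subseteq\{1,\ldots,n\}$, its code $c(S)\in\mathbb{N}_0^{n+1}$ is defined by $c(S)_i=0$ if $i\in S$ and $c(S)_i=i-\sum_{j=1}^{i-1}c(S)_j$ if $i\notin S$. The type $t(\phi)$ of a set partition $\phi$ is the sequence of the sizes of its blocks, the blocks being listed in lexicographic order (equivalently, in increasing order of their least elements). $\Pi_S$ is the set of all partitions $\phi$ of $\{1,\ldots,n+1\}$ such that $t(\phi)$ written backwards equals the sequence obtained from $c(S)$ by deleting its zero entries. -}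

module Defs where

open import Data.Nat using (ℕ; zero; suc; _+_; _∸_)
open import Data.Bool using (Bool; true; false; not; _∧_; _∨_; if_then_else_)
open import Data.Fin using (Fin; toℕ; _<?_)
open import Data.Fin.Subset using (Subset)
open import Data.Vec using (Vec; []; _∷_)
open import Data.List using (List; []; _∷_; reverse; allFin)
open import Relation.Nullary.Decidable using (⌊_⌋)
open import Relation.Binary.PropositionalEquality using (_≡_)

-- A set partition of {1,…,m} (encoded as Fin m, element k+1 ↦ index k)
-- given by its (decidable) equivalence relation "same block".
record Partition (m : ℕ) : Set where
  field
    same      : Fin m → Fin m → Bool
    same-refl  : ∀ i → same i i ≡ true
    same-sym   : ∀ i j → same i j ≡ same j i
    same-trans : ∀ i j k → same i j ≡ true → same j k ≡ true → same i k ≡ true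
open Partition public

count : ∀ {A : Set} → (A → Bool) → List A → ℕ
count p [] = 0
count p (x ∷ xs) = if p x then suc (count p xs) else count p xs

anyB : ∀ {A : Set} → (A → Bool) → List A → Bool
anyB p [] = false
anyB p (x ∷ xs) = p x ∨ anyB p xs

isLeast : ∀ {m} → Partition m → Fin m → Bool
isLeast φ i = not (anyB (λ j → ⌊ j <? i ⌋ ∧ same φ j i) (allFin _))

blockSize : ∀ {m} → Partition m → Fin m → ℕ
blockSize φ i = count (same φ i) (allFin _)

typeOf : ∀ {m} → Partition m → List ℕ
typeOf {m} φ = go (allFin m)
  where
  go : List (Fin m) → List ℕ
  go [] = []
  go (i ∷ is) = if isLeast φ i then blockSize φ i ∷ go is else go is

-- A subset S ⊆ {1,…,n} is a Subset n (position k ↦ element k+1; true = member).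
-- code S = c(S) = (c_1,…,c_{n+1}) as a list; n+1 ∉ S always.
-- codeFrom i acc bits: i = current (1-based) index, acc = c_1+…+c_{i-1}.
-- (i ∸ acc never truncates, since acc ≤ i-1 always.)
codeFrom : ∀ {k} → ℕ → ℕ → Vec Bool k → List ℕ
codeFrom i acc [] = (i ∸ acc) ∷ []
codeFrom i acc (true ∷ bs) = 0 ∷ codeFrom (suc i) acc bs
codeFrom i acc (false ∷ bs) = (i ∸ acc) ∷ codeFrom (suc i) (acc + (i ∸ acc)) bs

code : ∀ {n} → Subset n → List ℕ
code S = codeFrom 1 0 S

dropZeros : List ℕ → List ℕ
dropZeros [] = []
dropZeros (zero ∷ xs) = dropZeros xs
dropZeros (suc x ∷ xs) = suc x ∷ dropZeros xs

_∈Π_ : ∀ {n} → Partition (suc n) → Subset n → Set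
φ ∈Π S = reverse (typeOf φ) ≡ dropZeros (code S)

-- Both sides are compositions of n+1, i.e. lists of positive numbers summing
-- to n+1. The type of φ is one: its parts are block sizes, and counting the
-- pairs (i, j) with i the least element of the block of j gives Σ sizes when
-- grouped by i and n+1 when grouped by j. Reversal keeps it a composition.
-- On the other side, for i ∉ S the entry c(S)_i is the distance from i back to
-- the previous non-member of S (or to 0), so dropping the zeros of c(S) lists
-- the gaps between consecutive elements of {0} ∪ ({1,…,n+1} ∖ S): this is the
-- classical bijection between subsets of {1,…,n} and compositions of n+1.
{-# OPTIONS --safe #-}
module Submission where

open import Defs
open import Data.Nat using (ℕ; suc)
open import Data.Fin.Subset using (Subset)
open import Data.Product using (∃!)
open import Relation.Binary.PropositionalEquality using (_≡_)

open import Data.Bool using (Bool; true; false; not; _∧_; if_then_else_)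
open import Data.Bool.Properties using (∨-zeroʳ; ¬-not)
open import Data.Fin as Fin using (Fin; _<?_; punchIn)
open import Data.Fin.Properties using (<-cmp; punchInᵢ≢i)
open import Data.List using (List; []; _∷_; map; tabulate; allFin)
open import Data.List.Membership.Propositional using (_∈_)
open import Data.List.Membership.Propositional.Properties using (∈-allFin)
open import Data.List.Properties using (map-tabulate; ∷-injective; ∷-injectiveʳ)
open import Data.List.Relation.Binary.Permutation.Propositional using (_↭_; ↭-sym)
open import Data.List.Relation.Binary.Permutation.Propositional.Properties using (All-resp-↭; ↭-reverse)
open import Data.List.Relation.Unary.All using (All; []; _∷_)
open import Data.List.Relation.Unary.Any using (here; there)
open import Data.Nat using (zero; _+_; _<_; s≤s; z≤n)
open import Data.Nat.ListAction using (sum)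
open import Data.Nat.ListAction.Properties using (sum-↭)
open import Data.Nat.Properties
  using (+-0-commutativeMonoid; ≤-refl; <-irrefl; m<n⇒m<1+n; +-identityʳ; +-suc; +-comm; m+n∸m≡n;
         suc-injective)
open import Algebra.Properties.CommutativeMonoid.Sum +-0-commutativeMonoid
  using (sum-syntax; ∑-comm; sum-cong-≗; sum-remove; sum-replicate-zero)
open import Data.Product using (∃-syntax; _×_; _,_; proj₁)
open import Data.Vec using (Vec; []; _∷_)
open import Function using (_∘_; id)
open import Relation.Binary using (tri<; tri≈; tri>)
open import Relation.Binary.PropositionalEquality
  using (refl; subst; sym; trans; cong; cong₂; _≢_; module ≡-Reasoning)
open import Relation.Nullary using (yes; no)
open import Relation.Nullary.Decidable using (⌊_⌋)
open import Relation.Nullary.Negation using (contradiction)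

iverson : Bool → ℕ
iverson b = if b then 1 else 0

sum-tabulate : ∀ {m} (f : Fin m → ℕ) → sum (tabulate f) ≡ ∑[ i < m ] f i
sum-tabulate {zero} f = refl
sum-tabulate {suc m} f = cong (f Fin.zero +_) (sum-tabulate (f ∘ Fin.suc))

sum-map-allFin : ∀ {m} (f : Fin m → ℕ) → sum (map f (allFin m)) ≡ ∑[ i < m ] f i
sum-map-allFin f = trans (cong sum (map-tabulate id f)) (sum-tabulate f)

count≡sum-map-iverson : ∀ {A : Set} (p : A → Bool) xs → count p xs ≡ sum (map (iverson ∘ p) xs)
count≡sum-map-iverson p [] = refl
count≡sum-map-iverson p (x ∷ xs) with p x
... | true  = cong suc (count≡sum-map-iverson p xs)
... | false = count≡sum-map-iverson p xs

count-allFin : ∀ {m} (p : Fin m → Bool) → count p (allFin m) ≡ ∑[ i < m ] iverson (p i)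
count-allFin p = trans (count≡sum-map-iverson p (allFin _)) (sum-map-allFin (iverson ∘ p))

∑-one : ∀ m → ∑[ i < m ] 1 ≡ m
∑-one zero    = refl
∑-one (suc m) = cong suc (∑-one m)

∑-iverson-∧ : ∀ {m} b (p : Fin m → Bool) →
              (if b then ∑[ i < m ] iverson (p i) else 0) ≡ ∑[ i < m ] iverson (b ∧ p i)
∑-iverson-∧ true  p = refl
∑-iverson-∧ {m} false p = sym (sum-replicate-zero m)

∑-iverson-pos : ∀ {m} (p : Fin m → Bool) {k} → p k ≡ true → 0 < ∑[ i < m ] iverson (p i)
∑-iverson-pos {suc m} p {k} pk rewrite sum-remove {i = k} (iverson ∘ p) | pk = s≤s z≤n

∑-iverson-unique : ∀ {m} (p : Fin m → Bool) {k} → p k ≡ true → (∀ i → p i ≡ true → i ≡ k) →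
                   ∑[ i < m ] iverson (p i) ≡ 1
∑-iverson-unique {suc m} p {k} pk unique = begin
  ∑[ i < suc m ] iverson (p i)                          ≡⟨ sum-remove (iverson ∘ p) ⟩
  iverson (p k) + ∑[ i < m ] iverson (p (punchIn k i))  ≡⟨ cong₂ _+_ (cong iverson pk) (sum-cong-≗ others) ⟩
  1 + ∑[ i < m ] 0                                      ≡⟨ cong suc (sum-replicate-zero m) ⟩
  1                                                     ∎
  where
  open ≡-Reasoning
  others : ∀ i → iverson (p (punchIn k i)) ≡ 0
  others i = cong iverson (¬-not (punchInᵢ≢i k i ∘ unique (punchIn k i)))

anyB-false : ∀ {A : Set} (q : A → Bool) xs → (∀ x → q x ≡ false) → anyB q xs ≡ false
anyB-false q []       none = refl
anyB-false q (x ∷ xs) none rewrite none x = anyB-false q xs none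

anyB-true : ∀ {A : Set} (q : A → Bool) {x xs} → x ∈ xs → q x ≡ true → anyB q xs ≡ true
anyB-true q (here refl)     qx rewrite qx = refl
anyB-true q {xs = y ∷ _} (there x∈xs) qx rewrite anyB-true q x∈xs qx = ∨-zeroʳ (q y)

minimum : ∀ {m} (p : Fin m → Bool) {j} → p j ≡ true →
          ∃[ i ] p i ≡ true × (∀ k → k Fin.< i → p k ≡ false)
minimum p {Fin.zero} pj = Fin.zero , pj , λ _ ()
minimum p {Fin.suc j} pj with p Fin.zero in p₀
... | true  = Fin.zero , p₀ , λ _ ()
... | false with minimum (p ∘ Fin.suc) pj
...   | i , pi , below =
  Fin.suc i , pi , λ { Fin.zero _ → p₀ ; (Fin.suc k) (s≤s k<i) → below k k<i }

∧-true : ∀ {a b} → (a ∧ b) ≡ true → a ≡ true × b ≡ true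
∧-true {true} b≡true = refl , b≡true

-- The local function `go` of typeOf cannot be named directly; the meta in
-- blockSizes is solved by it once typeOf≡blockSizes abstracts over allFin m.
mutual
  blockSizes : ∀ {m} → Partition m → List (Fin m) → List ℕ
  blockSizes φ = _

  typeOf≡blockSizes : ∀ {m} (φ : Partition m) → typeOf φ ≡ blockSizes φ (allFin m)
  typeOf≡blockSizes {m} φ with allFin m
  ... | _ = refl

module _ {m} (φ : Partition m) where

  isLeast-true : ∀ {i} → (∀ k → k Fin.< i → same φ k i ≡ false) → isLeast φ i ≡ true
  isLeast-true {i} noEarlier = cong not (anyB-false _ (allFin m) noEarlier′)
    where
    noEarlier′ : ∀ k → (⌊ k <? i ⌋ ∧ same φ k i) ≡ false
    noEarlier′ k with k <? i
    ... | yes k<i = noEarlier k k<i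
    ... | no _    = refl

  isLeast-false : ∀ {k i} → k Fin.< i → same φ k i ≡ true → isLeast φ i ≡ false
  isLeast-false {k} {i} k<i k~i = cong not (anyB-true _ (∈-allFin k) earlier)
    where
    earlier : (⌊ k <? i ⌋ ∧ same φ k i) ≡ true
    earlier with k <? i
    ... | yes _   = k~i
    ... | no k≮i = contradiction k<i k≮i

  leads : Fin m → Fin m → Bool
  leads i j = isLeast φ i ∧ same φ i j

  unique-least-in-block : ∀ j → ∑[ i < m ] iverson (leads i j) ≡ 1
  unique-least-in-block j with minimum (λ i → same φ i j) (same-refl φ j)
  ... | i₀ , i₀~j , below =
    ∑-iverson-unique (λ i → leads i j) (cong₂ _∧_ i₀-least i₀~j) unique
    where
    i₀-least : isLeast φ i₀ ≡ true
    i₀-least = isLeast-true λ k k<i₀ → ¬-not λ k~i₀ →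
      contradiction (trans (sym (same-trans φ k i₀ j k~i₀ i₀~j)) (below k k<i₀)) λ ()
    unique : ∀ i → leads i j ≡ true → i ≡ i₀
    unique i p with ∧-true {isLeast φ i} p | <-cmp i i₀
    ... | _ , i~j | tri< i<i₀ _ _ = contradiction (trans (sym i~j) (below i i<i₀)) λ ()
    ... | _ , _   | tri≈ _ i≡i₀ _ = i≡i₀
    ... | i-least , i~j | tri> _ _ i₀<i =
      contradiction (trans (sym i-least) (isLeast-false i₀<i i₀~i)) λ ()
      where
      i₀~i : same φ i₀ i ≡ true
      i₀~i = same-trans φ i₀ j i i₀~j (trans (same-sym φ j i) i~j)

  blockSize≡∑ : ∀ i → blockSize φ i ≡ ∑[ j < m ] iverson (same φ i j)
  blockSize≡∑ i = count-allFin (same φ i)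

  blockSize-pos : ∀ i → 0 < blockSize φ i
  blockSize-pos i rewrite blockSize≡∑ i = ∑-iverson-pos (same φ i) (same-refl φ i)

  sizeIfLeast : Fin m → ℕ
  sizeIfLeast i = if isLeast φ i then blockSize φ i else 0

  blockSizes-pos : ∀ xs → All (0 <_) (blockSizes φ xs)
  blockSizes-pos []       = []
  blockSizes-pos (i ∷ xs) with isLeast φ i
  ... | true  = blockSize-pos i ∷ blockSizes-pos xs
  ... | false = blockSizes-pos xs

  sum-blockSizes : ∀ xs → sum (blockSizes φ xs) ≡ sum (map sizeIfLeast xs)
  sum-blockSizes []       = refl
  sum-blockSizes (i ∷ xs) with isLeast φ i
  ... | true  = cong (blockSize φ i +_) (sum-blockSizes xs)
  ... | false = sum-blockSizes xs

  sum-typeOf : sum (typeOf φ) ≡ m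
  sum-typeOf = begin
    sum (typeOf φ)                                  ≡⟨ cong sum (typeOf≡blockSizes φ) ⟩
    sum (blockSizes φ (allFin m))                   ≡⟨ sum-blockSizes (allFin m) ⟩
    sum (map sizeIfLeast (allFin m))                ≡⟨ sum-map-allFin sizeIfLeast ⟩
    ∑[ i < m ] sizeIfLeast i                        ≡⟨ sum-cong-≗ sizeIfLeast≡∑ ⟩
    ∑[ i < m ] ∑[ j < m ] iverson (leads i j)       ≡⟨ ∑-comm (λ i j → iverson (leads i j)) ⟩
    ∑[ j < m ] ∑[ i < m ] iverson (leads i j)       ≡⟨ sum-cong-≗ unique-least-in-block ⟩
    ∑[ j < m ] 1                                    ≡⟨ ∑-one m ⟩
    m                                               ∎
    where
    open ≡-Reasoning
    sizeIfLeast≡∑ : ∀ i → sizeIfLeast i ≡ ∑[ j < m ] iverson (leads i j)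
    sizeIfLeast≡∑ i rewrite blockSize≡∑ i = ∑-iverson-∧ (isLeast φ i) (same φ i)

IsComposition : ℕ → List ℕ → Set
IsComposition m xs = All (0 <_) xs × sum xs ≡ m

typeOf-isComposition : ∀ {m} (φ : Partition m) → IsComposition m (typeOf φ)
typeOf-isComposition {m} φ =
  subst (All (0 <_)) (sym (typeOf≡blockSizes φ)) (blockSizes-pos φ (allFin m)) , sum-typeOf φ

↭-isComposition : ∀ {m xs ys} → xs ↭ ys → IsComposition m xs → IsComposition m ys
↭-isComposition xs↭ys (pos , s) = All-resp-↭ xs↭ys pos , trans (sym (sum-↭ xs↭ys)) s

-- d is the size of the part still open: members of S extend it, non-members close it.
compositionFrom : ∀ {k} → ℕ → Vec Bool k → List ℕ
compositionFrom d []            = d ∷ []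
compositionFrom d (true  ∷ bs) = compositionFrom (suc d) bs
compositionFrom d (false ∷ bs) = d ∷ compositionFrom 1 bs

-- At position acc + suc d of codeFrom the open part is {acc+1, …, acc + suc d}.
dropZeros-codeFrom : ∀ {k} acc d (bs : Vec Bool k) →
                     dropZeros (codeFrom (acc + suc d) acc bs) ≡ compositionFrom (suc d) bs
dropZeros-codeFrom acc d [] rewrite m+n∸m≡n acc (suc d) = refl
dropZeros-codeFrom acc d (true ∷ bs) rewrite sym (+-suc acc (suc d)) =
  dropZeros-codeFrom acc (suc d) bs
dropZeros-codeFrom acc d (false ∷ bs) rewrite m+n∸m≡n acc (suc d) | +-comm 1 (acc + suc d) =
  cong (suc d ∷_) (dropZeros-codeFrom (acc + suc d) 0 bs)

dropZeros-code : ∀ {n} (S : Subset n) → dropZeros (code S) ≡ compositionFrom 1 S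
dropZeros-code = dropZeros-codeFrom 0 0

compositionFrom≢∷ : ∀ {k d e ys} (bs : Vec Bool k) → d < e → compositionFrom e bs ≢ d ∷ ys
compositionFrom≢∷ []            d<e eq = <-irrefl (sym (proj₁ (∷-injective eq))) d<e
compositionFrom≢∷ (true  ∷ bs) d<e    = compositionFrom≢∷ bs (m<n⇒m<1+n d<e)
compositionFrom≢∷ (false ∷ bs) d<e eq = <-irrefl (sym (proj₁ (∷-injective eq))) d<e

compositionFrom-injective : ∀ {k} d (bs bs′ : Vec Bool k) →
                            compositionFrom d bs ≡ compositionFrom d bs′ → bs ≡ bs′
compositionFrom-injective d []            []             eq = refl
compositionFrom-injective d (true  ∷ bs) (true  ∷ bs′) eq =
  cong (true ∷_) (compositionFrom-injective (suc d) bs bs′ eq)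
compositionFrom-injective d (false ∷ bs) (false ∷ bs′) eq =
  cong (false ∷_) (compositionFrom-injective 1 bs bs′ (∷-injectiveʳ eq))
compositionFrom-injective d (true  ∷ bs) (false ∷ bs′) eq = contradiction eq (compositionFrom≢∷ bs ≤-refl)
compositionFrom-injective d (false ∷ bs) (true  ∷ bs′) eq = contradiction (sym eq) (compositionFrom≢∷ bs′ ≤-refl)

compositionFrom-surjective : ∀ k d e xs → All (0 <_) xs → e + sum xs ≡ k →
                             ∃[ bs ] compositionFrom {k} d bs ≡ d + e ∷ xs
compositionFrom-surjective zero    d zero    []             _         _ = [] , cong (_∷ []) (sym (+-identityʳ d))
compositionFrom-surjective zero    d zero    (zero ∷ _)    (() ∷ _)  _
compositionFrom-surjective zero    d zero    (suc _ ∷ _)   _         ()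
compositionFrom-surjective zero    d (suc _) _             _         ()
compositionFrom-surjective (suc k) d zero    []            _         ()
compositionFrom-surjective (suc k) d (suc e) xs            pos       s
  with bs , eq ← compositionFrom-surjective k (suc d) e xs pos (suc-injective s)
  = true ∷ bs , trans eq (cong (_∷ xs) (sym (+-suc d e)))
compositionFrom-surjective (suc k) d zero    (suc y ∷ ys) (_ ∷ pos) s
  with bs , eq ← compositionFrom-surjective k 1 y ys pos (suc-injective s)
  = false ∷ bs , cong₂ _∷_ (sym (+-identityʳ d)) eq

∃!-dropZeros-code : ∀ {n xs} → IsComposition (suc n) xs →
                    ∃! _≡_ (λ (S : Subset n) → xs ≡ dropZeros (code S))
∃!-dropZeros-code {n} {suc e ∷ xs} (_ ∷ pos , s)
  with S , eq ← compositionFrom-surjective n 1 e xs pos (suc-injective s)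
  = S , trans (sym eq) (sym (dropZeros-code S)) ,
    λ {S′} eq′ → compositionFrom-injective 1 S S′ (trans eq (trans eq′ (dropZeros-code S′)))

lemma2 : (n : ℕ) → (φ : Partition (suc n)) → ∃! _≡_ (λ (S : Subset n) → φ ∈Π S)
lemma2 n φ =
  ∃!-dropZeros-code (↭-isComposition (↭-sym (↭-reverse (typeOf φ))) (typeOf-isComposition φ))
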